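{- Let $\sigma$ be a substitution and $\alpha$ a prenaming safe for $\sigma$. Then the set of pairs $\{\alpha(x)/\alpha(\sigma(x)) : x\in\mathrm{Dom}(\sigma)\}$ is a core representation of a substitution (i.e. the $\alpha(x)$, $x\in\mathrm{Dom}(\sigma)$, are pairwise distinct variables and $\alpha(x)\neq\alpha(\sigma(x))$ for each $x\in\mathrm{Dom}(\sigma)$), and $\alpha$ does not introduce aliasing: for $x_i,x_j\in\mathrm{Dom}(\sigma)$, if $\alpha(\sigma(x_i))$ and $\alpha(\sigma(x_j))$ share a variable then $\sigma(x_i)$ and $\sigma(x_j)$ share a variable.
   Context: $V$ is a countably infinite set of variables. A substitution maps variables to terms, is the identity outside the finite active domain $\mathrm{Dom}(\sigma)=\{x:\sigma(x)\neq x\}$, and acts homomorphically on terms; its core representation is the finite set of bindings $x/\sigma(x)$, $x\in\mathrm{Dom}(\sigma)$; $\mathrm{vars}(\sigma)=\mathrm{Dom}(\sigma)\cup\mathrm{vars}(\sigma(\mathrm{Dom}(\sigma)))$. A prenaming is a substitution $\alpha$ mapping variables to variables together with a fixed finite set $C^+(\alpha)\supseteq\mathrm{Dom}(\alpha)$ (relaxed core) on which $\alpha$ is injective; $R^+(\alpha)=\alpha(C^+(\alpha))$; $\mathrm{indom}(\alpha)=V\setminus(R^+(\alpha)\setminus C^+(\alpha))$; $\alpha$ is safe for $\sigma$ if $\mathrm{vars}(\sigma)\subseteq\mathrm{indom}(\alpha)$. -}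

module Defs where

open import Data.Nat using (ℕ)
open import Data.List using (List; []; _∷_)
open import Data.List.Relation.Unary.Any using (Any)
open import Data.List.Membership.Propositional using (_∈_)
open import Data.Product using (Σ; ∃; _×_)
open import Data.Sum using (_⊎_)
open import Relation.Nullary using (¬_)
open import Relation.Binary.PropositionalEquality using (_≡_; _≢_)

-- Variables are ℕ (a countably infinite set V).
-- First-order terms over an arbitrary set F of function symbols
-- (each application carries its list of arguments).
data Term (F : Set) : Set where
  var : ℕ → Term F
  fn  : F → List (Term F) → Term F

data _∈v_ {F : Set} (x : ℕ) : Term F → Set where
  here  : x ∈v var x
  inArg : ∀ {f ts} → Any (x ∈v_) ts → x ∈v fn f ts

mutual
  rename : {F : Set} → (ℕ → ℕ) → Term F → Term F
  rename ρ (var x)   = var (ρ x)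
  rename ρ (fn f ts) = fn f (renameList ρ ts)

  renameList : {F : Set} → (ℕ → ℕ) → List (Term F) → List (Term F)
  renameList ρ []       = []
  renameList ρ (t ∷ ts) = rename ρ t ∷ renameList ρ ts

-- A substitution: a map from variables to terms which is the identity
-- outside its finite active domain Dom(σ) = {x : σ(x) ≠ x}, listed by 'dom'.
record Subst (F : Set) : Set where
  field
    apply    : ℕ → Term F
    dom      : List ℕ
    dom-sound    : ∀ x → x ∈ dom → apply x ≢ var x
    dom-complete : ∀ x → apply x ≢ var x → x ∈ dom
open Subst public

InDom : {F : Set} → Subst F → ℕ → Set
InDom σ x = apply σ x ≢ var x

InVars : {F : Set} → Subst F → ℕ → Set
InVars σ y = InDom σ y ⊎ (∃ λ x → InDom σ x × y ∈v apply σ x)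

-- A prenaming: a variable-to-variable map α with a fixed finite set
-- C⁺(α) ⊇ Dom(α) (so Dom(α) is finite) on which α is injective.
record Prenaming : Set where
  field
    ren      : ℕ → ℕ
    core     : List ℕ
    dom⊆core : ∀ x → ren x ≢ x → x ∈ core
    inj-core : ∀ x y → x ∈ core → y ∈ core → ren x ≡ ren y → x ≡ y
open Prenaming public

InR⁺ : Prenaming → ℕ → Set
InR⁺ α y = ∃ λ x → x ∈ core α × ren α x ≡ y

InIndom : Prenaming → ℕ → Set
InIndom α y = ¬ (InR⁺ α y × ¬ (y ∈ core α))

SafeFor : {F : Set} → Prenaming → Subst F → Set
SafeFor α σ = ∀ y → InVars σ y → InIndom α y

ShareVar : {F : Set} → Term F → Term F → Set
ShareVar s t = ∃ λ v → v ∈v s × v ∈v t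

module Submission where

-- Everything rests on one fact about the prenaming: α is
-- injective on indom(α) = V ∖ (R⁺(α) ∖ C⁺(α)).  Inside the core C⁺(α) this is
-- the defining injectivity; outside the core α is the identity, and a
-- variable y ∉ C⁺(α) can only collide with the image of a core variable if
-- y ∈ R⁺(α) ∖ C⁺(α), which indom(α) excludes.  Safety puts every variable of
-- σ (its domain and the variables of its range) into indom(α), so α is
-- injective on vars(σ).  The three claims then follow:
--   * distinct domain variables keep distinct images;
--   * α(x) = α(σ(x)) would force σ(x) to be a variable z with α(z) = α(x),
--     hence z = x, contradicting x ∈ Dom(σ);
--   * a variable shared by α(σ(xi)) and α(σ(xj)) is the image of a variable
--     of σ(xi) and of one of σ(xj) (occurrence reflection for renaming), and
--     injectivity identifies these two preimages.

open import Defs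
open import Data.Nat using (ℕ)
open import Data.Nat.Properties using (_≟_)
open import Data.Product using (_×_; _,_; ∃)
open import Data.Sum using (inj₁; inj₂)
open import Data.List using (List; []; _∷_)
open import Data.List.Relation.Unary.Any using (Any; here; there)
open import Data.List.Membership.Propositional using (_∈_)
open import Data.List.Membership.DecPropositional _≟_ using (_∈?_)
open import Data.Empty using (⊥-elim)
open import Relation.Nullary using (¬_; yes; no)
open import Relation.Binary.PropositionalEquality
  using (_≡_; _≢_; refl; sym; trans; subst)

InjectiveOn : (ℕ → Set) → (ℕ → ℕ) → Set
InjectiveOn P ρ = ∀ x y → P x → P y → ρ x ≡ ρ y → x ≡ y

-- Occurrence reflection: every variable of ρ(t) is the image of a variable
-- of t.  This is what lets sharing after renaming be traced back to t.
mutual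
  occurs-rename : {F : Set} (ρ : ℕ → ℕ) (t : Term F) {v : ℕ} →
    v ∈v rename ρ t → ∃ λ u → u ∈v t × ρ u ≡ v
  occurs-rename ρ (var x) here = x , here , refl
  occurs-rename ρ (fn f ts) (inArg p) with occurs-renameList ρ ts p
  ... | u , q , ρu≡v = u , inArg q , ρu≡v

  occurs-renameList : {F : Set} (ρ : ℕ → ℕ) (ts : List (Term F)) {v : ℕ} →
    Any (v ∈v_) (renameList ρ ts) → ∃ λ u → Any (u ∈v_) ts × ρ u ≡ v
  occurs-renameList ρ (t ∷ ts) (here p) with occurs-rename ρ t p
  ... | u , q , ρu≡v = u , here q , ρu≡v
  occurs-renameList ρ (t ∷ ts) (there p) with occurs-renameList ρ ts p
  ... | u , q , ρu≡v = u , there q , ρu≡v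

rename-var-inv : {F : Set} (ρ : ℕ → ℕ) (t : Term F) {y : ℕ} →
  rename ρ t ≡ var y → ∃ λ z → t ≡ var z × ρ z ≡ y
rename-var-inv ρ (var z) refl = z , refl , refl

share-reflect : {F : Set} (P : ℕ → Set) (ρ : ℕ → ℕ) (s t : Term F) →
  InjectiveOn P ρ → (∀ u → u ∈v s → P u) → (∀ u → u ∈v t → P u) →
  ShareVar (rename ρ s) (rename ρ t) → ShareVar s t
share-reflect P ρ s t inj Ps Pt (v , v∈ρs , v∈ρt)
  with occurs-rename ρ s v∈ρs | occurs-rename ρ t v∈ρt
... | u₁ , u₁∈s , ρu₁≡v | u₂ , u₂∈t , ρu₂≡v =
  u₁ , u₁∈s , subst (_∈v t) (sym u₁≡u₂) u₂∈t
  where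
  u₁≡u₂ : u₁ ≡ u₂
  u₁≡u₂ = inj u₁ u₂ (Ps u₁ u₁∈s) (Pt u₂ u₂∈t) (trans ρu₁≡v (sym ρu₂≡v))

fixed-outside-core : (α : Prenaming) (y : ℕ) → ¬ (y ∈ core α) → ren α y ≡ y
fixed-outside-core α y y∉core with ren α y ≟ y
... | yes αy≡y = αy≡y
... | no  αy≢y = ⊥-elim (y∉core (dom⊆core α y αy≢y))

-- The key fact: a prenaming is injective on indom(α).  A core variable and
-- a non-core one cannot collide, because the non-core one would then lie in
-- R⁺(α) ∖ C⁺(α).
indom-injective : (α : Prenaming) → InjectiveOn (InIndom α) (ren α)
indom-injective α x y x∈indom y∈indom αx≡αy with x ∈? core α | y ∈? core α
... | yes x∈core | yes y∈core = inj-core α x y x∈core y∈core αx≡αy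
... | yes x∈core | no  y∉core =
  ⊥-elim (y∈indom ((x , x∈core , trans αx≡αy (fixed-outside-core α y y∉core)) , y∉core))
... | no  x∉core | yes y∈core =
  ⊥-elim (x∈indom ((y , y∈core , trans (sym αx≡αy) (fixed-outside-core α x x∉core)) , x∉core))
... | no  x∉core | no  y∉core =
  trans (sym (fixed-outside-core α x x∉core)) (trans αx≡αy (fixed-outside-core α y y∉core))

module _ {F : Set} (σ : Subst F) (α : Prenaming) (safe : SafeFor α σ) where

  dom-safe : ∀ x → InDom σ x → InIndom α x
  dom-safe x x∈dom = safe x (inj₁ x∈dom)

  range-safe : ∀ x → InDom σ x → ∀ u → u ∈v apply σ x → InIndom α u
  range-safe x x∈dom u u∈σx = safe u (inj₂ (x , x∈dom , u∈σx))

  binding-nontrivial : ∀ x → InDom σ x → var (ren α x) ≢ rename (ren α) (apply σ x)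
  binding-nontrivial x x∈dom αx≡ασx
    with rename-var-inv (ren α) (apply σ x) (sym αx≡ασx)
  ... | z , σx≡z , αz≡αx = x∈dom (subst (λ w → apply σ x ≡ var w) z≡x σx≡z)
    where
    z≡x : z ≡ x
    z≡x = indom-injective α z x
            (range-safe x x∈dom z (subst (z ∈v_) (sym σx≡z) here))
            (dom-safe x x∈dom) αz≡αx

mainTheorem17 : {F : Set} (σ : Subst F) (α : Prenaming) → SafeFor α σ →
    ((x y : ℕ) → InDom σ x → InDom σ y → ren α x ≡ ren α y → x ≡ y)
    × ((x : ℕ) → InDom σ x → var (ren α x) ≢ rename (ren α) (apply σ x))
    × ((xi xj : ℕ) → InDom σ xi → InDom σ xj →
    ShareVar (rename (ren α) (apply σ xi)) (rename (ren α) (apply σ xj)) →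
    ShareVar (apply σ xi) (apply σ xj))
mainTheorem17 σ α safe = domain-injective , binding-nontrivial σ α safe , no-aliasing
  where
  domain-injective : InjectiveOn (InDom σ) (ren α)
  domain-injective x y x∈dom y∈dom =
    indom-injective α x y (dom-safe σ α safe x x∈dom) (dom-safe σ α safe y y∈dom)

  no-aliasing : ∀ xi xj → InDom σ xi → InDom σ xj →
    ShareVar (rename (ren α) (apply σ xi)) (rename (ren α) (apply σ xj)) →
    ShareVar (apply σ xi) (apply σ xj)
  no-aliasing xi xj xi∈dom xj∈dom =
    share-reflect (InIndom α) (ren α) (apply σ xi) (apply σ xj) (indom-injective α)
      (range-safe σ α safe xi xi∈dom) (range-safe σ α safe xj xj∈dom)
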